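{- Let $A$ be a balanced quadriculated annulus, $\xi$ a cut, $\Delta$ the periodic track segment obtained by cutting $A$ along $\xi$, and $A^\infty=\cdots\Delta_{ -1}\Delta_0\Delta_1\cdots$ the universal cover of $A$, with induced cuts $\xi_{n+\frac12}$ between $\Delta_n$ and $\Delta_{n+1}$. Let $t$ be any domino tiling of $A^\infty$. Then the flux $\phi(t;\xi_{n+\frac12})$ is the same for all $n\in\mathbb{Z}$.
   Context: A balanced quadriculated annulus $A$ is a compact surface homeomorphic to $S^1\times[0,1]$, embedded in $\mathbb{R}^2$, made of unit squares glued along sides (interior vertices in exactly four squares), colored black/white with side-adjacent squares of opposite colors and equally many of each color. A cut $\xi$ is a simple path of vertices along sides of squares from the outer to the inner boundary with exactly one vertex on each boundary component. Cutting $A$ along $\xi$ gives a quadriculated disk $\Delta$; gluing infinitely many copies $\Delta_n$, $n\in\mathbb{Z}$, consecutively along the copies of $\xi$ gives the universal cover $A^\infty$ (a band) with the lifted quadriculation and coloring; the gluing line between $\Delta_n$ and $\Delta_{n+1}$ is the cut $\xi_{n+\frac12}$. The covering projection to $A$ induces on $A^\infty$ the notions of clockwise/counterclockwise direction. In each domino of a tiling draw the arrow from the black square to the white square; the flux $\phi(t;\xi_{n+\frac12})$ is the number of domino arrows of $t$ crossing $\xi_{n+\frac12}$ counterclockwise minus the number crossing it clockwise. -}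

module Defs where

open import Data.Nat using (ℕ; zero; suc)
open import Data.Integer using (ℤ; +_; _+_; -_; 1ℤ; 0ℤ)
open import Data.Fin using (Fin; zero; suc)
open import Data.Bool using (Bool; true; false; not)
open import Data.Product using (_×_; _,_; proj₁; proj₂)
open import Data.Sum using (_⊎_)
open import Relation.Binary.PropositionalEquality using (_≡_; _≢_)
open import Relation.Nullary using (¬_; yes; no)
open import Data.Integer.Properties using (_≟_)

count : ∀ {m} → (Fin m → Bool) → ℕ
count {zero}  p = zero
count {suc m} p with p zero
... | true  = suc (count (λ i → p (suc i)))
... | false = count (λ i → p (suc i))

sumℤ : ∀ {m} → (Fin m → ℤ) → ℤ
sumℤ {zero}  f = 0ℤ
sumℤ {suc m} f = f zero + sumℤ (λ i → f (suc i))

-- Combinatorial data of a balanced quadriculated annulus A together with a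
-- cut ξ, presented through the quadriculated disk Δ obtained by cutting
-- A along ξ.  The squares of A (= squares of Δ) are Fin m.
--   adj s s'  : s, s' share a side in Δ (i.e. a side of A not on ξ);
--   glue s s' : s and s' share a side lying on ξ, with s on the side of ξ
--               that in A^∞ belongs to Δ_n and s' on the side belonging to
--               Δ_{n+1}  (so s ∈ Δ_n, s' ∈ Δ_{n+1} meet along ξ_{n+1/2});
--   black s   : colour of s (true = black, false = white).
-- Convention: going from Δ_n to Δ_{n+1} is the counterclockwise direction.
record BalancedAnnulusWithCut : Set₁ where
  field
    m          : ℕ
    adj        : Fin m → Fin m → Set
    glue       : Fin m → Fin m → Set
    black      : Fin m → Bool
    adj-sym    : ∀ {s s'} → adj s s' → adj s' s
    adj-col    : ∀ {s s'} → adj s s' → black s ≢ black s'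
    glue-col   : ∀ {s s'} → glue s s' → black s ≢ black s'
    balanced   : count black ≡ count (λ s → not (black s))

module _ (A : BalancedAnnulusWithCut) where
  open BalancedAnnulusWithCut A

  -- Squares of the universal cover A^∞: (n , s) is the copy of s in Δ_n.
  Sq∞ : Set
  Sq∞ = ℤ × Fin m

  Adj∞ : Sq∞ → Sq∞ → Set
  Adj∞ (n , s) (k , s') =
      (k ≡ n × adj s s')
    ⊎ (k ≡ n + 1ℤ × glue s s')
    ⊎ (n ≡ k + 1ℤ × glue s' s)

  -- A domino tiling of A^∞: every square is matched with an adjacent
  -- square, the matching being an involution (the dominoes are {x, partner x}).
  record Tiling : Set where
    field
      partner     : Sq∞ → Sq∞
      partner-inv : ∀ x → partner (partner x) ≡ x
      partner-adj : ∀ x → Adj∞ x (partner x)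

  -- Contribution of square s of Δ_n to the flux through ξ_{n+1/2}:
  -- if its domino crosses into Δ_{n+1}, the arrow (black → white) crosses
  -- counterclockwise when s is black (+1) and clockwise when s is white (-1).
  fluxContrib : Tiling → ℤ → Fin m → ℤ
  fluxContrib t n s with proj₁ (Tiling.partner t (n , s)) ≟ n + 1ℤ
  ... | no _  = 0ℤ
  ... | yes _ with black s
  ...   | true  = 1ℤ
  ...   | false = - 1ℤ

  flux : Tiling → ℤ → ℤ
  flux t n = sumℤ (fluxContrib t n)

-- Let flow n k be the number of black squares of Δ_n whose domino partner lies in Δ_k minus the
-- number of such white squares, so that φ(t; ξ_{n+1/2}) = flow n (n+1).  A domino pairs squares of
-- opposite colours, hence flow n k + flow k n = 0: both are sums of one matrix indexed by pairs of
-- squares, read by rows and by columns.  In particular flow n n = 0.  Every square of Δ_{n+1} is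
-- matched into Δ_n, Δ_{n+1} or Δ_{n+2}, and Δ_{n+1} is balanced, so
-- flow (n+1) n + flow (n+1) (n+2) = 0, i.e. φ(ξ_{n+3/2}) = - flow (n+1) n = flow n (n+1) = φ(ξ_{n+1/2}).

module Submission where

open import Defs
open import Data.Integer using (ℤ)
open import Relation.Binary.PropositionalEquality using (_≡_)

import Data.Integer.Properties as ℤ
open import Algebra.Properties.AbelianGroup ℤ.+-0-abelianGroup
  using (inverseˡ-unique; inverseʳ-unique; ∙-cancelʳ)
open import Algebra.Properties.CommutativeMonoid.Sum ℤ.+-0-commutativeMonoid
  using (sum; sum-cong-≗; sum-replicate-zero; sum-remove; ∑-comm; ∑-distrib-+)
open import Data.Bool using (Bool; true; false; not)
open import Data.Nat using (ℕ; zero; suc)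
open import Data.Empty using (⊥-elim)
open import Data.Fin using (Fin; zero; suc; punchIn)
open import Data.Fin.Properties using (punchInᵢ≢i)
import Data.Fin.Properties as Fin
open import Data.Integer using (+_; -[1+_]; _+_; -_; _<_; _⊖_; 0ℤ; 1ℤ; -1ℤ)
  renaming (suc to sucℤ)
open import Data.Integer.Properties
  using (+-identityˡ; +-identityʳ; +-comm; <⇒≢; <-trans; suc[i]≤j⇒i<j; ≤-refl; n⊖n≡0;
         distribʳ-⊖-+-pos; distribʳ-⊖-+-neg)
open import Data.Product using (_×_; _,_; proj₁; proj₂)
open import Data.Product.Properties using (≡-dec; ,-injective)
open import Data.Sum using (_⊎_; inj₁; inj₂)
open import Function using (_∘_)
open import Relation.Binary.Definitions using (DecidableEquality)
open import Relation.Binary.PropositionalEquality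
  using (_≢_; refl; sym; trans; cong; cong₂; module ≡-Reasoning)
open import Relation.Nullary using (¬_; Dec; yes; no)

sumℤ≡sum : ∀ {m} (f : Fin m → ℤ) → sumℤ f ≡ sum f
sumℤ≡sum {zero}  f = refl
sumℤ≡sum {suc m} f = cong (_+_ (f zero)) (sumℤ≡sum (f ∘ suc))

sum-zero : ∀ {m} {f : Fin m → ℤ} → (∀ i → f i ≡ 0ℤ) → sum f ≡ 0ℤ
sum-zero {m} f≗0 = trans (sum-cong-≗ f≗0) (sum-replicate-zero m)

sum-single : ∀ {m} (i : Fin m) {f : Fin m → ℤ} → (∀ j → j ≢ i → f j ≡ 0ℤ) → sum f ≡ f i
sum-single {suc m} i {f} vanish = begin
  sum f                                  ≡⟨ sum-remove {i = i} f ⟩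
  f i + sum (λ j → f (punchIn i j))     ≡⟨ cong (_+_ (f i)) (sum-zero (λ j → vanish _ (punchInᵢ≢i i j))) ⟩
  f i + 0ℤ                               ≡⟨ +-identityʳ (f i) ⟩
  f i                                    ∎
  where open ≡-Reasoning

when : ∀ {P : Set} → Dec P → ℤ → ℤ
when (yes _) v = v
when (no _)  v = 0ℤ

when-yes : ∀ {P : Set} (d : Dec P) {v} → P → when d v ≡ v
when-yes (yes _) p = refl
when-yes (no ¬p) p = ⊥-elim (¬p p)

when-no : ∀ {P : Set} (d : Dec P) {v} → ¬ P → when d v ≡ 0ℤ
when-no (yes p) ¬p = ⊥-elim (¬p p)
when-no (no _)  ¬p = refl

when-partition : ∀ {x a b c : ℤ} v → a ≢ b → a ≢ c → b ≢ c → x ≡ a ⊎ x ≡ b ⊎ x ≡ c →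
                 when (x ℤ.≟ a) v + when (x ℤ.≟ b) v + when (x ℤ.≟ c) v ≡ v
when-partition {x} v a≢b a≢c b≢c (inj₁ refl) = trans
  (cong₂ _+_ (cong₂ _+_ (when-yes (x ℤ.≟ _) refl) (when-no (x ℤ.≟ _) a≢b)) (when-no (x ℤ.≟ _) a≢c))
  (trans (+-identityʳ _) (+-identityʳ v))
when-partition {x} v a≢b a≢c b≢c (inj₂ (inj₁ refl)) = trans
  (cong₂ _+_ (cong₂ _+_ (when-no (x ℤ.≟ _) (a≢b ∘ sym)) (when-yes (x ℤ.≟ _) refl)) (when-no (x ℤ.≟ _) b≢c))
  (trans (+-identityʳ _) (+-identityˡ v))
when-partition {x} v a≢b a≢c b≢c (inj₂ (inj₂ refl)) = trans
  (cong₂ _+_ (cong₂ _+_ (when-no (x ℤ.≟ _) (a≢c ∘ sym)) (when-no (x ℤ.≟ _) (b≢c ∘ sym))) (when-yes (x ℤ.≟ _) refl))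
  (+-identityˡ v)

sign : Bool → ℤ
sign true  = 1ℤ
sign false = -1ℤ

sign-cancel : ∀ {b b′} → b ≢ b′ → sign b + sign b′ ≡ 0ℤ
sign-cancel {true}  {true}  b≢b′ = ⊥-elim (b≢b′ refl)
sign-cancel {true}  {false} b≢b′ = refl
sign-cancel {false} {true}  b≢b′ = refl
sign-cancel {false} {false} b≢b′ = ⊥-elim (b≢b′ refl)

sum-sign≡count⊖count : ∀ {m} (p : Fin m → Bool) → sum (sign ∘ p) ≡ count p ⊖ count (not ∘ p)
sum-sign≡count⊖count {zero}  p = refl
sum-sign≡count⊖count {suc m} p with p zero
... | true  = trans (cong (_+_ 1ℤ) (sum-sign≡count⊖count (p ∘ suc)))
                  (distribʳ-⊖-+-pos 1 (count (p ∘ suc)) (count (not ∘ p ∘ suc)))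
... | false = trans (cong (_+_ -1ℤ) (sum-sign≡count⊖count (p ∘ suc)))
                  (distribʳ-⊖-+-neg 0 (count (p ∘ suc)) (count (not ∘ p ∘ suc)))

i+i≡0⇒i≡0 : ∀ {i} → i + i ≡ 0ℤ → i ≡ 0ℤ
i+i≡0⇒i≡0 {+ zero}    _  = refl
i+i≡0⇒i≡0 {+ suc n}   ()
i+i≡0⇒i≡0 { -[1+ n ]} ()

i<i+1 : ∀ i → i < i + 1ℤ
i<i+1 i rewrite +-comm i 1ℤ = suc[i]≤j⇒i<j ≤-refl

sucℤ-invariant⇒constant : ∀ {A : Set} (f : ℤ → A) → (∀ k → f k ≡ f (sucℤ k)) → ∀ n → f n ≡ f 0ℤ
sucℤ-invariant⇒constant f step (+ zero)     = refl
sucℤ-invariant⇒constant f step (+ suc n)    = trans (sym (step (+ n))) (sucℤ-invariant⇒constant f step (+ n))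
sucℤ-invariant⇒constant f step -[1+ zero ]  = step -[1+ zero ]
sucℤ-invariant⇒constant f step -[1+ suc n ] = trans (step -[1+ suc n ]) (sucℤ-invariant⇒constant f step -[1+ n ])

module Flow {I : Set} (_≟ᴵ_ : DecidableEquality I) {m : ℕ}
  (partner : I × Fin m → I × Fin m)
  (partner-involutive : ∀ x → partner (partner x) ≡ x)
  (charge : Fin m → ℤ)
  (charge-cancel : ∀ x → charge (proj₂ x) + charge (proj₂ (partner x)) ≡ 0ℤ)
  where

  _≟_ : DecidableEquality (I × Fin m)
  _≟_ = ≡-dec _≟ᴵ_ Fin._≟_

  flow : I → I → ℤ
  flow i j = sum (λ s → when (proj₁ (partner (i , s)) ≟ᴵ j) (charge s))

  pairing : I → I → Fin m → Fin m → ℤ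
  pairing i j s s′ = when (partner (i , s) ≟ (j , s′)) (charge s)

  partner-flip : ∀ {x y} → partner x ≡ y → partner y ≡ x
  partner-flip {x} refl = partner-involutive x

  pairing-cancel : ∀ i j s s′ → pairing i j s s′ + pairing j i s′ s ≡ 0ℤ
  pairing-cancel i j s s′ with partner (i , s) ≟ (j , s′)
  ... | yes p = begin
    charge s + when (partner (j , s′) ≟ (i , s)) (charge s′)
      ≡⟨ cong (_+_ (charge s)) (when-yes (partner (j , s′) ≟ (i , s)) (partner-flip p)) ⟩
    charge s + charge s′
      ≡⟨ cong (λ y → charge s + charge (proj₂ y)) (sym p) ⟩
    charge s + charge (proj₂ (partner (i , s)))
      ≡⟨ charge-cancel (i , s) ⟩
    0ℤ ∎
    where open ≡-Reasoning
  ... | no ¬p = trans (+-identityˡ _) (when-no (partner (j , s′) ≟ (i , s)) (¬p ∘ partner-flip))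

  sum-when-≟ : ∀ x j v → sum (λ s′ → when (x ≟ (j , s′)) v) ≡ when (proj₁ x ≟ᴵ j) v
  sum-when-≟ (i , t) j v = by-cases (i ≟ᴵ j)
    where
    by-cases : Dec (i ≡ j) → sum (λ s′ → when ((i , t) ≟ (j , s′)) v) ≡ when (i ≟ᴵ j) v
    by-cases (yes i≡j) = begin
      sum (λ s′ → when ((i , t) ≟ (j , s′)) v)
        ≡⟨ sum-single t (λ s′ s′≢t → when-no ((i , t) ≟ (j , s′)) (s′≢t ∘ sym ∘ proj₂ ∘ ,-injective)) ⟩
      when ((i , t) ≟ (j , t)) v
        ≡⟨ when-yes ((i , t) ≟ (j , t)) (cong (_, t) i≡j) ⟩
      v
        ≡⟨ when-yes (i ≟ᴵ j) i≡j ⟨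
      when (i ≟ᴵ j) v ∎
      where open ≡-Reasoning
    by-cases (no i≢j) = trans
      (sum-zero (λ s′ → when-no ((i , t) ≟ (j , s′)) (i≢j ∘ proj₁ ∘ ,-injective)))
      (sym (when-no (i ≟ᴵ j) i≢j))

  sum-pairing : ∀ i j s → sum (pairing i j s) ≡ when (proj₁ (partner (i , s)) ≟ᴵ j) (charge s)
  sum-pairing i j s = sum-when-≟ (partner (i , s)) j (charge s)

  flow-antisym : ∀ i j → flow i j + flow j i ≡ 0ℤ
  flow-antisym i j = begin
    flow i j + flow j i
      ≡⟨ cong₂ _+_ (sum-cong-≗ (sum-pairing i j)) (sum-cong-≗ (sum-pairing j i)) ⟨
    sum (λ s → sum (pairing i j s)) + sum (λ s′ → sum (pairing j i s′))
      ≡⟨ cong (_+_ (sum (λ s → sum (pairing i j s)))) (∑-comm (pairing j i)) ⟩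
    sum (λ s → sum (pairing i j s)) + sum (λ s → sum (λ s′ → pairing j i s′ s))
      ≡⟨ ∑-distrib-+ (λ s → sum (pairing i j s)) _ ⟨
    sum (λ s → sum (pairing i j s) + sum (λ s′ → pairing j i s′ s))
      ≡⟨ sum-cong-≗ (λ s → sym (∑-distrib-+ (pairing i j s) _)) ⟩
    sum (λ s → sum (λ s′ → pairing i j s s′ + pairing j i s′ s))
      ≡⟨ sum-zero (λ s → sum-zero (pairing-cancel i j s)) ⟩
    0ℤ ∎
    where open ≡-Reasoning

  flow-diagonal : ∀ i → flow i i ≡ 0ℤ
  flow-diagonal i = i+i≡0⇒i≡0 (flow-antisym i i)

module _ (A : BalancedAnnulusWithCut) (t : Tiling A) where
  open BalancedAnnulusWithCut A
  open Tiling t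

  Adj∞-colours : ∀ {x y} → Adj∞ A x y → black (proj₂ x) ≢ black (proj₂ y)
  Adj∞-colours {_ , _} {_ , _} (inj₁ (_ , a))        = adj-col a
  Adj∞-colours {_ , _} {_ , _} (inj₂ (inj₁ (_ , g))) = glue-col g
  Adj∞-colours {_ , _} {_ , _} (inj₂ (inj₂ (_ , g))) = glue-col g ∘ sym

  Adj∞-layers : ∀ k s y → Adj∞ A (k + 1ℤ , s) y →
                proj₁ y ≡ k ⊎ proj₁ y ≡ k + 1ℤ ⊎ proj₁ y ≡ k + 1ℤ + 1ℤ
  Adj∞-layers k s (j , _) (inj₁ (j≡k+1 , _))          = inj₂ (inj₁ j≡k+1)
  Adj∞-layers k s (j , _) (inj₂ (inj₁ (j≡k+2 , _)))   = inj₂ (inj₂ j≡k+2)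
  Adj∞-layers k s (j , _) (inj₂ (inj₂ (k+1≡j+1 , _))) = inj₁ (∙-cancelʳ 1ℤ j k (sym k+1≡j+1))

  open Flow ℤ._≟_ partner partner-inv (sign ∘ black) (λ x → sign-cancel (Adj∞-colours (partner-adj x)))

  flux≡flow : ∀ n → flux A t n ≡ flow n (n + 1ℤ)
  flux≡flow n = trans (sumℤ≡sum (fluxContrib A t n)) (sum-cong-≗ contribution)
    where
    contribution : ∀ s → fluxContrib A t n s ≡ when (proj₁ (partner (n , s)) ℤ.≟ n + 1ℤ) (sign (black s))
    contribution s with proj₁ (partner (n , s)) ℤ.≟ n + 1ℤ
    ... | no _ = refl
    ... | yes _ with black s
    ...   | true  = refl
    ...   | false = refl

  sum-sign-black : sum (sign ∘ black) ≡ 0ℤ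
  sum-sign-black = begin
    sum (sign ∘ black)                  ≡⟨ sum-sign≡count⊖count black ⟩
    count black ⊖ count (not ∘ black)   ≡⟨ cong (count black ⊖_) balanced ⟨
    count black ⊖ count black           ≡⟨ n⊖n≡0 (count black) ⟩
    0ℤ                                  ∎
    where open ≡-Reasoning

  flow-balance : ∀ k → flow (k + 1ℤ) k + flow (k + 1ℤ) (k + 1ℤ) + flow (k + 1ℤ) (k + 1ℤ + 1ℤ) ≡ 0ℤ
  flow-balance k = begin
    sum f₀ + sum f₁ + sum f₂                    ≡⟨ cong (_+ sum f₂) (∑-distrib-+ f₀ f₁) ⟨
    sum (λ s → f₀ s + f₁ s) + sum f₂            ≡⟨ ∑-distrib-+ (λ s → f₀ s + f₁ s) f₂ ⟨
    sum (λ s → f₀ s + f₁ s + f₂ s)              ≡⟨ sum-cong-≗ partition ⟩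
    sum (sign ∘ black)                          ≡⟨ sum-sign-black ⟩
    0ℤ                                          ∎
    where
    open ≡-Reasoning
    layer-of : Fin m → ℤ
    layer-of s = proj₁ (partner (k + 1ℤ , s))
    f₀ f₁ f₂ : Fin m → ℤ
    f₀ s = when (layer-of s ℤ.≟ k) (sign (black s))
    f₁ s = when (layer-of s ℤ.≟ k + 1ℤ) (sign (black s))
    f₂ s = when (layer-of s ℤ.≟ k + 1ℤ + 1ℤ) (sign (black s))
    partition : ∀ s → f₀ s + f₁ s + f₂ s ≡ sign (black s)
    partition s = when-partition (sign (black s))
      (<⇒≢ (i<i+1 k)) (<⇒≢ (<-trans (i<i+1 k) (i<i+1 (k + 1ℤ)))) (<⇒≢ (i<i+1 (k + 1ℤ)))
      (Adj∞-layers k s (partner (k + 1ℤ , s)) (partner-adj (k + 1ℤ , s)))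

  flux-step : ∀ k → flux A t k ≡ flux A t (k + 1ℤ)
  flux-step k = begin
    flux A t k         ≡⟨ flux≡flow k ⟩
    flow k (k + 1ℤ)    ≡⟨ inverseˡ-unique _ _ (flow-antisym k (k + 1ℤ)) ⟩
    - backward         ≡⟨ inverseʳ-unique backward forward backward+forward≡0 ⟨
    forward            ≡⟨ flux≡flow (k + 1ℤ) ⟨
    flux A t (k + 1ℤ)  ∎
    where
    open ≡-Reasoning
    backward forward : ℤ
    backward = flow (k + 1ℤ) k
    forward  = flow (k + 1ℤ) (k + 1ℤ + 1ℤ)
    backward+forward≡0 : backward + forward ≡ 0ℤ
    backward+forward≡0 = begin
      backward + forward                           ≡⟨ cong (_+ forward) (+-identityʳ backward) ⟨
      backward + 0ℤ + forward                      ≡⟨ cong (λ d → backward + d + forward) (flow-diagonal (k + 1ℤ)) ⟨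
      backward + flow (k + 1ℤ) (k + 1ℤ) + forward  ≡⟨ flow-balance k ⟩
      0ℤ                                           ∎

lemma2p1 : (A : BalancedAnnulusWithCut) (t : Tiling A) (n k : ℤ) →
    flux A t n ≡ flux A t k
lemma2p1 A t n k = trans (flux≡flux₀ n) (sym (flux≡flux₀ k))
  where
  flux≡flux₀ : ∀ n → flux A t n ≡ flux A t 0ℤ
  flux≡flux₀ = sucℤ-invariant⇒constant (flux A t)
    (λ k → trans (flux-step A t k) (cong (flux A t) (+-comm k 1ℤ)))
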